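{- Let $\Gamma$ be a simple graph with $s$ edges, let $G$ be a group of order $mn$ with $\lambda(m-1)n=2st$ for positive integers $\lambda,t$, and let $H$ be a subgroup of $G$ of order $n$. Assume that $A$ is a subgroup of $\mathrm{Aut}(G)$ whose order $d$ divides $\gcd(mn-n,t)$ and which acts semiregularly on $G\setminus H$. Assume also that $\mathcal{I}$ is a collection of $t/d$ $\Gamma$-subgraphs of $\mathbb{K}_{G:H}$ such that $\Delta\mathcal{I}$ is evenly distributed over the $(m-1)n/d$ orbits of $A$ on $G\setminus H$. Then $\mathcal{I}$ is a collection of initial base blocks of an $(mn,n,\Gamma,\lambda)$ difference family in $G$ relative to $H$, i.e., the family $(B^\alpha)_{B\in\mathcal{I},\,\alpha\in A}$ is such a difference family.
   Context: $G$ is written multiplicatively. $\mathbb{K}_{G:H}$ is the complete multipartite graph with vertex set $G$ whose parts are the right cosets of $H$ in $G$; a $\Gamma$-subgraph is a subgraph isomorphic to $\Gamma$. For a graph $B$ with vertices in $G$, $\Delta B$ is the multiset of $xy^{ -1}$ over all ordered pairs $(x,y)$ of adjacent vertices; $\Delta$ of a collection is the multiset union. For $\alpha\in\mathrm{Aut}(G)$, $B^\alpha$ is obtained by applying $\alpha$ to the vertices of $B$. Semiregular on $G\setminus H$: no non-identity element of $A$ fixes an element of $G\setminus H$. Evenly distributed: every $A$-orbit on $G\setminus H$ contains the same number of elements of $\Delta\mathcal{I}$ (with multiplicity). An $(mn,n,\Gamma,\lambda)$ difference family in $G$ relative to $H$ is a collection of $\Gamma$-subgraphs of $\mathbb{K}_{G:H}$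 whose list of differences contains every element of $G\setminus H$ exactly $\lambda$ times. -}

module Defs where

open import Level using (0ℓ)
open import Data.Nat using (ℕ; zero; suc)
open import Data.Fin using (Fin; _≟_)
open import Data.Fin.Properties using (any?)
open import Data.Fin.Subset using (Subset; _∈_; _∉_; ∣_∣)
open import Data.Product using (Σ; ∃; _×_; _,_; proj₁; proj₂)
open import Data.Sum using (_⊎_)
open import Data.List.Membership.Propositional as LM using ()
open import Data.List using (List; []; _∷_; length; filter; concatMap; map; allFin)
open import Data.Vec using (Vec; lookup; toList)
open import Relation.Nullary using (¬_)
open import Relation.Binary.PropositionalEquality using (_≡_; _≢_)
open import Algebra.Structures using (IsGroup)
open import Function.Definitions using (Injective; Bijective)

-- A finite group of order N, with carrier Fin N (every finite group of
-- order N is isomorphic to one of this form).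

record FinGroup (N : ℕ) : Set where
  infixl 7 _∙_
  infix 8 _⁻¹
  field
    _∙_     : Fin N → Fin N → Fin N
    ε       : Fin N
    _⁻¹     : Fin N → Fin N
    isGroup : IsGroup (_≡_ {A = Fin N}) _∙_ ε _⁻¹

module _ {N : ℕ} (G : FinGroup N) where
  open FinGroup G

  IsSubgroup : Subset N → Set
  IsSubgroup H = (ε ∈ H)
               × (∀ x y → x ∈ H → y ∈ H → (x ∙ y) ∈ H)
               × (∀ x → x ∈ H → (x ⁻¹) ∈ H)

  IsAut : (Fin N → Fin N) → Set
  IsAut α = Bijective _≡_ _≡_ α × (∀ x y → α (x ∙ y) ≡ α x ∙ α y)

  -- A : Fin d → Aut(G) lists the elements of a subgroup of Aut(G) of order d
  -- (pairwise distinct as maps, contains the identity, closed under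
  -- composition and inverses).
  IsAutSubgroup : (d : ℕ) → (Fin d → Fin N → Fin N) → Set
  IsAutSubgroup d A =
      (∀ i → IsAut (A i))
    × (∀ i j → (∀ x → A i x ≡ A j x) → i ≡ j)
    × (∃ λ i → ∀ x → A i x ≡ x)
    × (∀ i j → ∃ λ k → ∀ x → A k x ≡ A i (A j x))
    × (∀ i → ∃ λ j → ∀ x → A j (A i x) ≡ x)

  ActsOnComplement : Subset N → (d : ℕ) → (Fin d → Fin N → Fin N) → Set
  ActsOnComplement H d A = ∀ i x → x ∉ H → A i x ∉ H

  Semiregular : Subset N → (d : ℕ) → (Fin d → Fin N → Fin N) → Set
  Semiregular H d A = ∀ i x → x ∉ H → A i x ≡ x → ∀ y → A i y ≡ y

SameEdge : ∀ {v} → Fin v × Fin v → Fin v × Fin v → Set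
SameEdge (a , b) (c , e) = (a ≡ c × b ≡ e) ⊎ (a ≡ e × b ≡ c)

IsSimpleGraph : ∀ {v s} → Vec (Fin v × Fin v) s → Set
IsSimpleGraph {v} {s} E =
    (∀ i → proj₁ (lookup E i) ≢ proj₂ (lookup E i))
  × (∀ i j → SameEdge (lookup E i) (lookup E j) → i ≡ j)

module _ {N : ℕ} (G : FinGroup N) where
  open FinGroup G

  -- A Γ-subgraph of K_{G:H}, Γ = (Fin v, E), is given by an injective
  -- embedding φ : Fin v → G such that adjacent vertices lie in different
  -- right cosets of H (Hx ≠ Hy iff x y⁻¹ ∉ H); the subgraph is the image.
  IsΓSubgraph : ∀ {v s} → Vec (Fin v × Fin v) s → Subset N → (Fin v → Fin N) → Set
  IsΓSubgraph E H φ =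
    Injective _≡_ _≡_ φ × (∀ i → (φ (proj₁ (lookup E i)) ∙ φ (proj₂ (lookup E i)) ⁻¹) ∉ H)

  Δ : ∀ {v s} → Vec (Fin v × Fin v) s → (Fin v → Fin N) → List (Fin N)
  Δ E φ = concatMap (λ e → (φ (proj₁ e) ∙ φ (proj₂ e) ⁻¹) ∷ (φ (proj₂ e) ∙ φ (proj₁ e) ⁻¹) ∷ [])
                    (toList E)

  Δs : ∀ {v s} → Vec (Fin v × Fin v) s → List (Fin v → Fin N) → List (Fin N)
  Δs E Bs = concatMap (Δ E) Bs

mult : ∀ {N} → Fin N → List (Fin N) → ℕ
mult g xs = length (filter (_≟ g) xs)

multOrbit : ∀ {N d} → (Fin d → Fin N → Fin N) → Fin N → List (Fin N) → ℕ
multOrbit A x xs = length (filter (λ δ → any? (λ i → A i x ≟ δ)) xs)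

orbitFamily : ∀ {N v k d} → Vec (Fin v → Fin N) k → (Fin d → Fin N → Fin N)
            → List (Fin v → Fin N)
orbitFamily {d = d} I A =
  concatMap (λ φ → map (λ i x → A i (φ x)) (allFin d)) (toList I)

module _ {N : ℕ} (G : FinGroup N) where
  IsDifferenceFamily : ∀ {v s} → Vec (Fin v × Fin v) s → Subset N → ℕ
                     → List (Fin v → Fin N) → Set
  IsDifferenceFamily E H λ' F =
      (∀ φ → φ LM.∈ F → IsΓSubgraph G E H φ)
    × (∀ g → g ∉ H → mult g (Δs G E F) ≡ λ')

-- Semiregularity makes i ↦ A i δ injective for every δ ∉ H.  Hence, for g ∉ H, a
-- difference δ of a base block B reappears as g among the differences of the images
-- Bᵅ exactly once if δ lies in the A-orbit of g, and never otherwise; so g occurs in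
-- the differences of the whole family as often as ΔI meets the orbit of g, a constant c
-- by even distribution.  All these differences lie in G ∖ H, so counting them gives
-- c ∣G ∖ H∣ = (t/d) d · 2s = λ (m − 1) n = λ ∣G ∖ H∣, whence c = λ.
module Submission where

open import Defs
open import Level using (0ℓ)
open import Algebra.Bundles using (Group)
open import Algebra.Structures using (module IsGroup)
import Algebra.Properties.Group as GroupProperties
open import Data.Nat using (ℕ; zero; suc; _+_; _*_; _∸_; _>_; NonZero; z≤n; >-nonZero)
open import Data.Nat.Properties
  using (+-commutativeSemigroup; *-comm; *-zeroʳ; *-identityˡ; *-identityʳ; *-distribˡ-+
        ; *-distribʳ-∸; *-cancelʳ-≡; ≤-<-trans)
open import Algebra.Properties.CommutativeSemigroup +-commutativeSemigroup using (interchange)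
open import Data.Nat.ListAction using (sum)
open import Data.Nat.Divisibility using (_∣_)
open import Data.Nat.GCD using (gcd)
open import Data.Fin using (Fin; zero; suc; _≟_)
open import Data.Fin.Properties using (any?)
open import Data.Fin.Subset using (Subset; _∈_; _∉_; ∣_∣; ∁; ⁅_⁆; inside; outside)
open import Data.Fin.Subset.Properties
  using (_∈?_; drop-there; x∈⁅x⁆; x∈⁅y⁆⇒x≡y; ∣⁅x⁆∣≡1; x∈∁p⇒x∉p; x∉p⇒x∈∁p; ∣∁p∣≡n∸∣p∣
        ; x∈p⇒p-x⊂p; p⊂q⇒∣p∣<∣q∣)
open import Data.Product using (_×_; ∃; _,_; proj₁; proj₂)
open import Data.List using (List; []; _∷_; [_]; _++_; length; filter; concatMap; map; allFin)
open import Data.List.Properties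
  using (length-++; length-map; length-tabulate; filter-++; filter-≐; filter-none; map-cong
        ; map-tabulate; concatMap-cong; concatMap-map; concatMap-pure; concatMap-++; map-concatMap)
open import Data.List.Relation.Unary.All as All using (All; []; _∷_)
open import Data.List.Relation.Unary.All.Properties using (++⁺; concat⁺; map⁺)
open import Data.Vec using (Vec; lookup; toList)
import Data.Vec as Vec
open import Data.Vec.Properties using (length-toList)
open import Function using (_∘_)
open import Relation.Nullary using (yes; no)
open import Relation.Unary using (Pred; Decidable; _≐_)
import Relation.Binary.Definitions as Binary
open import Relation.Binary.PropositionalEquality
  using (_≡_; _≢_; refl; sym; trans; cong; cong₂; subst; _≗_; module ≡-Reasoning)

module _ {a} {A : Set a} where

  count : ∀ {p} {P : Pred A p} → Decidable P → List A → ℕ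
  count P? xs = length (filter P? xs)

  count-++ : ∀ {p} {P : Pred A p} (P? : Decidable P) xs ys →
             count P? (xs ++ ys) ≡ count P? xs + count P? ys
  count-++ P? xs ys = trans (cong length (filter-++ P? xs ys)) (length-++ (filter P? xs))

  count-≐ : ∀ {p q} {P : Pred A p} {Q : Pred A q} (P? : Decidable P) (Q? : Decidable Q) →
            P ≐ Q → count P? ≗ count Q?
  count-≐ P? Q? P≐Q xs = cong length (filter-≐ P? Q? P≐Q xs)

  sum-map-+ : ∀ (f g : A → ℕ) xs → sum (map (λ x → f x + g x) xs) ≡ sum (map f xs) + sum (map g xs)
  sum-map-+ f g []       = refl
  sum-map-+ f g (x ∷ xs) = trans (cong (f x + g x +_) (sum-map-+ f g xs)) (interchange (f x) (g x) _ _)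

  sum-map-*ˡ : ∀ c (f : A → ℕ) xs → sum (map (λ x → c * f x) xs) ≡ c * sum (map f xs)
  sum-map-*ˡ c f []       = sym (*-zeroʳ c)
  sum-map-*ˡ c f (x ∷ xs) = trans (cong (c * f x +_) (sum-map-*ˡ c f xs)) (sym (*-distribˡ-+ c (f x) _))

  sum-map-const : ∀ {c} {f : A → ℕ} → (∀ x → f x ≡ c) → ∀ xs → sum (map f xs) ≡ length xs * c
  sum-map-const f≡c []       = refl
  sum-map-const f≡c (x ∷ xs) = cong₂ _+_ (f≡c x) (sum-map-const f≡c xs)

module _ {a b} {A : Set a} {B : Set b} where

  count-map : ∀ {p} {P : Pred B p} (P? : Decidable P) (f : A → B) xs →
              count P? (map f xs) ≡ count (P? ∘ f) xs
  count-map P? f []       = refl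
  count-map P? f (x ∷ xs) with P? (f x)
  ... | yes _ = cong suc (count-map P? f xs)
  ... | no _  = count-map P? f xs

  count-concatMap : ∀ {p} {P : Pred B p} (P? : Decidable P) (f : A → List B) xs →
                    count P? (concatMap f xs) ≡ sum (map (count P? ∘ f) xs)
  count-concatMap P? f []       = refl
  count-concatMap P? f (x ∷ xs) =
    trans (count-++ P? (f x) (concatMap f xs)) (cong (count P? (f x) +_) (count-concatMap P? f xs))

  length-concatMap-const : ∀ {c} {f : A → List B} → (∀ x → length (f x) ≡ c) → ∀ xs →
                           length (concatMap f xs) ≡ length xs * c
  length-concatMap-const         f≡c []       = refl
  length-concatMap-const {f = f} f≡c (x ∷ xs) =
    trans (length-++ (f x)) (cong₂ _+_ (f≡c x) (length-concatMap-const f≡c xs))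

concatMap-concatMap : ∀ {a b c} {A : Set a} {B : Set b} {C : Set c} (g : B → List C) (f : A → List B) xs →
                      concatMap g (concatMap f xs) ≡ concatMap (concatMap g ∘ f) xs
concatMap-concatMap g f []       = refl
concatMap-concatMap g f (x ∷ xs) =
  trans (concatMap-++ g (f x) (concatMap f xs)) (cong (concatMap g (f x) ++_) (concatMap-concatMap g f xs))

count≡sum-singletons : ∀ {a p} {A : Set a} {P : Pred A p} (P? : Decidable P) xs →
                       count P? xs ≡ sum (map (λ x → count P? [ x ]) xs)
count≡sum-singletons P? xs = trans (cong (count P?) (sym (concatMap-pure xs))) (count-concatMap P? [_] xs)

sum-count-swap : ∀ {a b r} {A : Set a} {B : Set b} {R : A → B → Set r} (R? : Binary.Decidable R) xs ys →
                 sum (map (λ x → count (R? x) ys) xs) ≡ sum (map (λ y → count (λ x → R? x y) xs) ys)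
sum-count-swap R? []       ys = sym (trans (sum-map-const (λ _ → refl) ys) (*-zeroʳ (length ys)))
sum-count-swap R? (x ∷ xs) ys = begin
  count (R? x) ys + sum (map (λ x′ → count (R? x′) ys) xs)
    ≡⟨ cong₂ _+_ (count≡sum-singletons (R? x) ys) (sum-count-swap R? xs ys) ⟩
  sum (map (λ y → count (R? x) [ y ]) ys) + sum (map (λ y → count (λ x′ → R? x′ y) xs) ys)
    ≡⟨ cong (_+ _) (cong sum (map-cong transpose ys)) ⟩
  sum (map (λ y → count (λ x′ → R? x′ y) [ x ]) ys) + sum (map (λ y → count (λ x′ → R? x′ y) xs) ys)
    ≡⟨ sum-map-+ (λ y → count (λ x′ → R? x′ y) [ x ]) (λ y → count (λ x′ → R? x′ y) xs) ys ⟨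
  sum (map (λ y → count (λ x′ → R? x′ y) [ x ] + count (λ x′ → R? x′ y) xs) ys)
    ≡⟨ cong sum (map-cong (λ y → count-++ (λ x′ → R? x′ y) [ x ] xs) ys) ⟨
  sum (map (λ y → count (λ x′ → R? x′ y) (x ∷ xs)) ys) ∎
  where
  open ≡-Reasoning
  transpose : ∀ y → count (R? x) [ y ] ≡ count (λ x′ → R? x′ y) [ x ]
  transpose y with R? x y
  ... | yes _ = refl
  ... | no _  = refl

allFin-suc : ∀ n → allFin (suc n) ≡ zero ∷ map suc (allFin n)
allFin-suc n = cong (zero ∷_) (sym (map-tabulate (λ i → i) suc))

count-∈-allFin : ∀ {n} (p : Subset n) → count (_∈? p) (allFin n) ≡ ∣ p ∣
count-∈-allFin {zero}  Vec.[]       = refl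
count-∈-allFin {suc n} (x Vec.∷ p) = begin
  count (_∈? (x Vec.∷ p)) (allFin (suc n))
    ≡⟨ cong (count (_∈? (x Vec.∷ p))) (allFin-suc n) ⟩
  count (_∈? (x Vec.∷ p)) ([ zero ] ++ map suc (allFin n))
    ≡⟨ count-++ (_∈? (x Vec.∷ p)) [ zero ] (map suc (allFin n)) ⟩
  count (_∈? (x Vec.∷ p)) [ zero ] + count (_∈? (x Vec.∷ p)) (map suc (allFin n))
    ≡⟨ cong (count (_∈? (x Vec.∷ p)) [ zero ] +_) tail ⟩
  count (_∈? (x Vec.∷ p)) [ zero ] + ∣ p ∣
    ≡⟨ head x ⟩
  ∣ x Vec.∷ p ∣ ∎
  where
  open ≡-Reasoning
  tail : count (_∈? (x Vec.∷ p)) (map suc (allFin n)) ≡ ∣ p ∣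
  tail = trans (count-map (_∈? (x Vec.∷ p)) suc (allFin n))
               (trans (count-≐ _ (_∈? p) (drop-there , Vec.there) (allFin n)) (count-∈-allFin p))
  head : ∀ x → count (_∈? (x Vec.∷ p)) [ zero ] + ∣ p ∣ ≡ ∣ x Vec.∷ p ∣
  head inside  = refl
  head outside = refl

count-allFin-unique : ∀ {n p} {P : Pred (Fin n) p} (P? : Decidable P) (j : Fin n) →
                      P ≐ (_≡ j) → count P? (allFin n) ≡ 1
count-allFin-unique {P = P} P? j (P⇒≡j , ≡j⇒P) = begin
  count P? (allFin _)            ≡⟨ count-≐ P? (_∈? ⁅ j ⁆) (P⇒∈⁅j⁆ , ≡j⇒P ∘ x∈⁅y⁆⇒x≡y j) (allFin _) ⟩
  count (_∈? ⁅ j ⁆) (allFin _)   ≡⟨ count-∈-allFin ⁅ j ⁆ ⟩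
  ∣ ⁅ j ⁆ ∣                      ≡⟨ ∣⁅x⁆∣≡1 j ⟩
  1                              ∎
  where
  open ≡-Reasoning
  P⇒∈⁅j⁆ : ∀ {i} → P i → i ∈ ⁅ j ⁆
  P⇒∈⁅j⁆ Pi = subst (_∈ ⁅ j ⁆) (sym (P⇒≡j Pi)) (x∈⁅x⁆ j)

length≡sum-mult : ∀ {N} (xs : List (Fin N)) → length xs ≡ sum (map (λ g → mult g xs) (allFin N))
length≡sum-mult {N} xs = begin
  length xs                                       ≡⟨ *-identityʳ (length xs) ⟨
  length xs * 1                                   ≡⟨ sum-map-const once xs ⟨
  sum (map (λ x → count (x ≟_) (allFin N)) xs)    ≡⟨ sum-count-swap _≟_ xs (allFin N) ⟩
  sum (map (λ g → mult g xs) (allFin N))          ∎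
  where
  open ≡-Reasoning
  once : ∀ x → count (x ≟_) (allFin N) ≡ 1
  once x = count-allFin-unique (x ≟_) x (sym , sym)

length-uniform : ∀ {N c} (H : Subset N) (xs : List (Fin N)) → All (_∉ H) xs →
                 (∀ g → g ∉ H → mult g xs ≡ c) → length xs ≡ c * ∣ ∁ H ∣
length-uniform {N} {c} H xs xs-∉ uniform = begin
  length xs
    ≡⟨ length≡sum-mult xs ⟩
  sum (map (λ g → mult g xs) (allFin N))
    ≡⟨ cong sum (map-cong pointwise (allFin N)) ⟩
  sum (map (λ g → c * count (_∈? ∁ H) [ g ]) (allFin N))
    ≡⟨ sum-map-*ˡ c (λ g → count (_∈? ∁ H) [ g ]) (allFin N) ⟩
  c * sum (map (λ g → count (_∈? ∁ H) [ g ]) (allFin N))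
    ≡⟨ cong (c *_) (count≡sum-singletons (_∈? ∁ H) (allFin N)) ⟨
  c * count (_∈? ∁ H) (allFin N)
    ≡⟨ cong (c *_) (count-∈-allFin (∁ H)) ⟩
  c * ∣ ∁ H ∣ ∎
  where
  open ≡-Reasoning
  pointwise : ∀ g → mult g xs ≡ c * count (_∈? ∁ H) [ g ]
  pointwise g with g ∈? ∁ H
  ... | yes g∈∁H = trans (uniform g (x∈∁p⇒x∉p g∈∁H)) (sym (*-identityʳ c))
  ... | no  g∉∁H = trans (cong length (filter-none (_≟ g) (All.map ≢g xs-∉))) (sym (*-zeroʳ c))
    where
    ≢g : ∀ {x} → x ∉ H → x ≢ g
    ≢g x∉H refl = g∉∁H (x∉p⇒x∈∁p x∉H)

x∈p⇒NonZero∣p∣ : ∀ {n x} {p : Subset n} → x ∈ p → NonZero ∣ p ∣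
x∈p⇒NonZero∣p∣ x∈p = >-nonZero (≤-<-trans z≤n (p⊂q⇒∣p∣<∣q∣ (x∈p⇒p-x⊂p x∈p)))

∣∁p∣≡[m∸1]*n : ∀ m {n} (p : Subset (m * n)) → ∣ p ∣ ≡ n → ∣ ∁ p ∣ ≡ (m ∸ 1) * n
∣∁p∣≡[m∸1]*n m {n} p ∣p∣≡n = begin
  ∣ ∁ p ∣         ≡⟨ ∣∁p∣≡n∸∣p∣ p ⟩
  m * n ∸ ∣ p ∣   ≡⟨ cong (m * n ∸_) ∣p∣≡n ⟩
  m * n ∸ n       ≡⟨ cong (m * n ∸_) (*-identityˡ n) ⟨
  m * n ∸ 1 * n   ≡⟨ *-distribʳ-∸ n m 1 ⟨
  (m ∸ 1) * n     ∎
  where open ≡-Reasoning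

module _ {N} (G : FinGroup N) where
  open FinGroup G
  open import Algebra.Morphism.Definitions (Fin N) (Fin N) _≡_ using (Homomorphic₂)

  private
    group : Group 0ℓ 0ℓ
    group = record { Carrier = Fin N ; _≈_ = _≡_ ; _∙_ = _∙_ ; ε = ε ; _⁻¹ = _⁻¹ ; isGroup = isGroup }
    open GroupProperties group using (identityˡ-unique; inverseˡ-unique; ⁻¹-anti-homo-//)
    open IsGroup isGroup using (identityˡ; inverseˡ)

  homo-ε : ∀ {f} → Homomorphic₂ f _∙_ _∙_ → f ε ≡ ε
  homo-ε {f} homo = identityˡ-unique (f ε) (f ε) (trans (sym (homo ε ε)) (cong f (identityˡ ε)))

  homo-⁻¹ : ∀ {f} → Homomorphic₂ f _∙_ _∙_ → ∀ x → f (x ⁻¹) ≡ f x ⁻¹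
  homo-⁻¹ {f} homo x =
    inverseˡ-unique (f (x ⁻¹)) (f x) (trans (sym (homo (x ⁻¹) x)) (trans (cong f (inverseˡ x)) (homo-ε homo)))

  homo-∙⁻¹ : ∀ {f} → Homomorphic₂ f _∙_ _∙_ → ∀ x y → f (x ∙ y ⁻¹) ≡ f x ∙ f y ⁻¹
  homo-∙⁻¹ {f} homo x y = trans (homo x (y ⁻¹)) (cong (f x ∙_) (homo-⁻¹ homo y))

  Δ-homo : ∀ {v s} (E : Vec (Fin v × Fin v) s) {f} → Homomorphic₂ f _∙_ _∙_ →
           ∀ φ → Δ G E (f ∘ φ) ≡ map f (Δ G E φ)
  Δ-homo E {f} homo φ = sym (trans (map-concatMap f _ (toList E)) (concatMap-cong both-differences (toList E)))
    where
    both-differences : ∀ ((a , b) : Fin _ × Fin _) →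
                       map f (φ a ∙ φ b ⁻¹ ∷ φ b ∙ φ a ⁻¹ ∷ [])
                         ≡ f (φ a) ∙ f (φ b) ⁻¹ ∷ f (φ b) ∙ f (φ a) ⁻¹ ∷ []
    both-differences (a , b) = cong₂ _∷_ (homo-∙⁻¹ homo _ _) (cong₂ _∷_ (homo-∙⁻¹ homo _ _) refl)

  Δ-∉ : ∀ {H} → IsSubgroup G H → ∀ {v s} (E : Vec (Fin v × Fin v) s) φ →
        (∀ i → φ (proj₁ (lookup E i)) ∙ φ (proj₂ (lookup E i)) ⁻¹ ∉ H) → All (_∉ H) (Δ G E φ)
  Δ-∉     H≤G Vec.[]      φ edges-∉ = []
  Δ-∉ {H} H≤G (e Vec.∷ E) φ edges-∉ = edges-∉ zero ∷ swap-∉ (edges-∉ zero) ∷ Δ-∉ H≤G E φ (edges-∉ ∘ suc)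
    where
    swap-∉ : ∀ {x y} → x ∙ y ⁻¹ ∉ H → y ∙ x ⁻¹ ∉ H
    swap-∉ {x} {y} xy⁻¹∉H yx⁻¹∈H = xy⁻¹∉H (subst (_∈ H) (⁻¹-anti-homo-// y x) (proj₂ (proj₂ H≤G) _ yx⁻¹∈H))

  Δs-∉ : ∀ {H} → IsSubgroup G H → ∀ {v s} (E : Vec (Fin v × Fin v) s) {Bs} →
         All (IsΓSubgraph G E H) Bs → All (_∉ H) (Δs G E Bs)
  Δs-∉ H≤G E Bs-Γ = concat⁺ (map⁺ (All.map (λ {φ} φ-Γ → Δ-∉ H≤G E φ (proj₂ φ-Γ)) Bs-Γ))

  IsΓSubgraph-∘ : ∀ {H f} → IsAut G f → (∀ x → x ∉ H → f x ∉ H) →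
                  ∀ {v s} (E : Vec (Fin v × Fin v) s) {φ} → IsΓSubgraph G E H φ → IsΓSubgraph G E H (f ∘ φ)
  IsΓSubgraph-∘ ((f-injective , _) , homo) f-∉ E (φ-injective , edges-∉) =
    φ-injective ∘ f-injective , λ i → subst (_∉ _) (homo-∙⁻¹ homo _ _) (f-∉ _ (edges-∉ i))

  length-Δs : ∀ {v s} (E : Vec (Fin v × Fin v) s) Bs → length (Δs G E Bs) ≡ length Bs * (2 * s)
  length-Δs {s = s} E = length-concatMap-const length-Δ
    where
    length-Δ : ∀ φ → length (Δ G E φ) ≡ 2 * s
    length-Δ φ = trans (length-concatMap-const (λ _ → refl) (toList E))
                       (trans (cong (_* 2) (length-toList E)) (*-comm s 2))

length-orbitFamily : ∀ {N v k d} (I : Vec (Fin v → Fin N) k) (A : Fin d → Fin N → Fin N) →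
                     length (orbitFamily I A) ≡ k * d
length-orbitFamily {d = d} I A =
  trans (length-concatMap-const (λ φ → trans (length-map _ (allFin d)) (length-tabulate _)) (toList I))
        (cong (_* d) (length-toList I))

module OrbitCounting {N} (G : FinGroup N) (H : Subset N) {d} (A : Fin d → Fin N → Fin N)
                     (A≤AutG : IsAutSubgroup G d A) (acts : ActsOnComplement G H d A)
                     (semiregular : Semiregular G H d A) where

  private
    faithful : ∀ i j → (∀ x → A i x ≡ A j x) → i ≡ j
    faithful = proj₁ (proj₂ A≤AutG)

    compose : ∀ i j → ∃ λ k → ∀ x → A k x ≡ A i (A j x)
    compose = proj₁ (proj₂ (proj₂ (proj₂ A≤AutG)))

    inv : Fin d → Fin d
    inv i = proj₁ (proj₂ (proj₂ (proj₂ (proj₂ A≤AutG))) i)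

    inv-left : ∀ i x → A (inv i) (A i x) ≡ x
    inv-left i = proj₂ (proj₂ (proj₂ (proj₂ (proj₂ A≤AutG))) i)

    inv-right : ∀ i x → A i (A (inv i) x) ≡ x
    inv-right i x with proj₂ (proj₁ (proj₁ A≤AutG i)) x
    ... | (z , Az≡x) = begin
      A i (A (inv i) x)          ≡⟨ cong (A i ∘ A (inv i)) (Az≡x refl) ⟨
      A i (A (inv i) (A i z))    ≡⟨ cong (A i) (inv-left i z) ⟩
      A i z                      ≡⟨ Az≡x refl ⟩
      x                          ∎
      where open ≡-Reasoning

  orbit? : ∀ x → Decidable (λ δ → ∃ λ i → A i x ≡ δ)
  orbit? x δ = any? (λ i → A i x ≟ δ)

  images : List (Fin N) → List (Fin N)
  images xs = concatMap (λ i → map (A i) xs) (allFin d)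

  orbit-injective : ∀ {δ i j} → δ ∉ H → A i δ ≡ A j δ → i ≡ j
  orbit-injective {δ} {i} {j} δ∉H Aiδ≡Ajδ = faithful i j (λ y → begin
    A i y                         ≡⟨ inv-right j (A i y) ⟨
    A j (A (inv j) (A i y))       ≡⟨ cong (A j) (k≗j⁻¹i y) ⟨
    A j (A k y)                   ≡⟨ cong (A j) (k-trivial y) ⟩
    A j y                         ∎)
    where
    open ≡-Reasoning
    k = proj₁ (compose (inv j) i)
    k≗j⁻¹i : ∀ x → A k x ≡ A (inv j) (A i x)
    k≗j⁻¹i = proj₂ (compose (inv j) i)
    k-trivial : ∀ y → A k y ≡ y
    k-trivial = semiregular k δ δ∉H (trans (k≗j⁻¹i δ) (trans (cong (A (inv j)) Aiδ≡Ajδ) (inv-left j δ)))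

  -- By semiregularity at most one element of A carries δ to g,
  -- and one does iff δ lies in the orbit of g.
  count-transporters : ∀ {g} → g ∉ H → ∀ δ → count (λ i → A i δ ≟ g) (allFin d) ≡ count (orbit? g) [ δ ]
  count-transporters {g} g∉H δ with orbit? g δ
  ... | yes (j , Ajg≡δ) = count-allFin-unique (λ i → A i δ ≟ g) (inv j) (unique , λ { refl → Aj⁻¹δ≡g })
    where
    Aj⁻¹δ≡g : A (inv j) δ ≡ g
    Aj⁻¹δ≡g = trans (cong (A (inv j)) (sym Ajg≡δ)) (inv-left j g)
    unique : ∀ {i} → A i δ ≡ g → i ≡ inv j
    unique Aiδ≡g = orbit-injective (subst (_∉ H) Ajg≡δ (acts j g g∉H)) (trans Aiδ≡g (sym Aj⁻¹δ≡g))
  ... | no δ∉gᴬ = cong length (filter-none (λ i → A i δ ≟ g) (All.universal never (allFin d)))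
    where
    never : ∀ i → A i δ ≢ g
    never i Aiδ≡g = δ∉gᴬ (inv i , trans (cong (A (inv i)) (sym Aiδ≡g)) (inv-left i δ))

  mult-images : ∀ {g} → g ∉ H → ∀ xs → mult g (images xs) ≡ count (orbit? g) xs
  mult-images {g} g∉H xs = begin
    count (_≟ g) (images xs)
      ≡⟨ count-concatMap (_≟ g) (λ i → map (A i) xs) (allFin d) ⟩
    sum (map (λ i → count (_≟ g) (map (A i) xs)) (allFin d))
      ≡⟨ cong sum (map-cong (λ i → count-map (_≟ g) (A i) xs) (allFin d)) ⟩
    sum (map (λ i → count (λ δ → A i δ ≟ g) xs) (allFin d))
      ≡⟨ sum-count-swap (λ i δ → A i δ ≟ g) (allFin d) xs ⟩
    sum (map (λ δ → count (λ i → A i δ ≟ g) (allFin d)) xs)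
      ≡⟨ cong sum (map-cong (count-transporters g∉H) xs) ⟩
    sum (map (λ δ → count (orbit? g) [ δ ]) xs)
      ≡⟨ count≡sum-singletons (orbit? g) xs ⟨
    count (orbit? g) xs ∎
    where open ≡-Reasoning

  Δs-orbitFamily : ∀ {v s k} (E : Vec (Fin v × Fin v) s) (I : Vec (Fin v → Fin N) k) →
                   Δs G E (orbitFamily I A) ≡ concatMap (images ∘ Δ G E) (toList I)
  Δs-orbitFamily E I =
    trans (concatMap-concatMap (Δ G E) _ (toList I)) (concatMap-cong Δ-orbit (toList I))
    where
    Δ-orbit : ∀ φ → concatMap (Δ G E) (map (λ i → A i ∘ φ) (allFin d)) ≡ images (Δ G E φ)
    Δ-orbit φ = trans (concatMap-map (Δ G E) (λ i → A i ∘ φ) (allFin d))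
                      (concatMap-cong (λ i → Δ-homo G E (proj₂ (proj₁ A≤AutG i)) φ) (allFin d))

  mult-orbitFamily : ∀ {v s k g} (E : Vec (Fin v × Fin v) s) (I : Vec (Fin v → Fin N) k) → g ∉ H →
                     mult g (Δs G E (orbitFamily I A)) ≡ multOrbit A g (Δs G E (toList I))
  mult-orbitFamily {g = g} E I g∉H = begin
    mult g (Δs G E (orbitFamily I A))
      ≡⟨ cong (mult g) (Δs-orbitFamily E I) ⟩
    count (_≟ g) (concatMap (images ∘ Δ G E) (toList I))
      ≡⟨ count-concatMap (_≟ g) (images ∘ Δ G E) (toList I) ⟩
    sum (map (count (_≟ g) ∘ images ∘ Δ G E) (toList I))
      ≡⟨ cong sum (map-cong (mult-images g∉H ∘ Δ G E) (toList I)) ⟩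
    sum (map (count (orbit? g) ∘ Δ G E) (toList I))
      ≡⟨ count-concatMap (orbit? g) (Δ G E) (toList I) ⟨
    multOrbit A g (Δs G E (toList I)) ∎
    where open ≡-Reasoning

  orbitFamily-IsΓSubgraph : ∀ {v s k} (E : Vec (Fin v × Fin v) s) (I : Vec (Fin v → Fin N) k) →
                            (∀ j → IsΓSubgraph G E H (lookup I j)) → All (IsΓSubgraph G E H) (orbitFamily I A)
  orbitFamily-IsΓSubgraph E Vec.[]      I-Γ = []
  orbitFamily-IsΓSubgraph E (φ Vec.∷ I) I-Γ =
    ++⁺ (map⁺ (All.universal (λ i → IsΓSubgraph-∘ G (proj₁ A≤AutG i) (acts i) E (I-Γ zero)) (allFin d)))
        (orbitFamily-IsΓSubgraph E I (I-Γ ∘ suc))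

theorem5p11 : ∀ (v s : ℕ) (E : Vec (Fin v × Fin v) s) → IsSimpleGraph E →
    ∀ (m n λ' t : ℕ) → λ' > 0 → t > 0 → λ' * ((m ∸ 1) * n) ≡ 2 * s * t →
    (G : FinGroup (m * n)) →
    (H : Subset (m * n)) → IsSubgroup G H → ∣ H ∣ ≡ n →
    (d : ℕ) (A : Fin d → Fin (m * n) → Fin (m * n)) → IsAutSubgroup G d A →
    d ∣ gcd (m * n ∸ n) t →
    ActsOnComplement G H d A → Semiregular G H d A →
    (k : ℕ) → k * d ≡ t →
    (I : Vec (Fin v → Fin (m * n)) k) →
    (∀ j → IsΓSubgraph G E H (lookup I j)) →
    (∃ λ c → ∀ x → x ∉ H → multOrbit A x (Δs G E (toList I)) ≡ c) →
    IsDifferenceFamily G E H λ' (orbitFamily I A)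
theorem5p11 v s E _ m n λ' t _ _ λ[m-1]n≡2st G H H≤G ∣H∣≡n d A A≤AutG _ acts semiregular
            k kd≡t I I-Γ (c , evenly) =
  (λ _ → All.lookup F-Γ) , mult≡λ
  where
  open OrbitCounting G H A A≤AutG acts semiregular
  F = orbitFamily I A
  F-Γ = orbitFamily-IsΓSubgraph E I I-Γ

  mult≡c : ∀ g → g ∉ H → mult g (Δs G E F) ≡ c
  mult≡c g g∉H = trans (mult-orbitFamily E I g∉H) (evenly g g∉H)

  c∣∁H∣≡λ∣∁H∣ : c * ∣ ∁ H ∣ ≡ λ' * ∣ ∁ H ∣
  c∣∁H∣≡λ∣∁H∣ = begin
    c * ∣ ∁ H ∣           ≡⟨ length-uniform H (Δs G E F) (Δs-∉ G H≤G E F-Γ) mult≡c ⟨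
    length (Δs G E F)     ≡⟨ length-Δs G E F ⟩
    length F * (2 * s)    ≡⟨ cong (_* (2 * s)) (trans (length-orbitFamily I A) kd≡t) ⟩
    t * (2 * s)           ≡⟨ trans (*-comm t (2 * s)) (sym λ[m-1]n≡2st) ⟩
    λ' * ((m ∸ 1) * n)    ≡⟨ cong (λ' *_) (∣∁p∣≡[m∸1]*n m H ∣H∣≡n) ⟨
    λ' * ∣ ∁ H ∣          ∎
    where open ≡-Reasoning

  mult≡λ : ∀ g → g ∉ H → mult g (Δs G E F) ≡ λ'
  mult≡λ g g∉H = trans (mult≡c g g∉H)
    (*-cancelʳ-≡ c λ' ∣ ∁ H ∣ {{x∈p⇒NonZero∣p∣ (x∉p⇒x∈∁p g∉H)}} c∣∁H∣≡λ∣∁H∣)
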